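{- Let $T$ be a non-empty finite set of positive integers with largest element $c$. For each positive integer $k$, let $(a^{(k)}_n)_{n\ge1}$ be the $S_k$-LID sequence where $S_k=[k]\setminus(k-T)$. Then for every positive integer $k$, $a^{(k)}_n=n$ for all $1\le n\le k-c+1$. Moreover, for every integer $i$ there exists an integer $f_T(i)$ (depending only on $T$ and $i$) such that $a^{(k)}_{k+i}=k+f_T(i)$ for every integer $k$ with $k>-i$ and $k\ge i+2c-1$.
   Context: $[k]=\{1,\dots,k\}$ and $k-T=\{k-t:t\in T\}$. For a set $S$ of positive integers, the $S$-legal index difference ($S$-LID) sequence $(a_n)_{n\ge 1}$ is defined recursively: for each positive integer $n$, $a_n$ is the smallest positive integer that cannot be written as $\sum_{\ell\in L} a_\ell$ for some set $L \subseteq \{1,\dots,n-1\}$ such that $|i-j|\notin S$ for all $i,j\in L$ (the empty sum is $0$). -}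

module Defs where

open import Data.Nat using (ℕ; _+_; _≤_; _<_; ∣_-_∣)
open import Data.List using (List; map)
open import Data.Nat.ListAction using (sum)
open import Data.List.Membership.Propositional using (_∈_)
open import Data.List.Relation.Unary.All using (All)
open import Data.List.Relation.Unary.Unique.Propositional using (Unique)
open import Data.Product using (Σ; _×_)
open import Relation.Nullary using (¬_)
open import Relation.Binary.PropositionalEquality using (_≡_)

-- A set S of positive integers is given as a predicate on ℕ.
-- A sequence (a_n)_{n ≥ 1} is a function ℕ → ℕ (the value at 0 is irrelevant).

LegalIndexSet : (S : ℕ → Set) → ℕ → List ℕ → Set
LegalIndexSet S n L =
  Unique L
  × All (λ ℓ → 1 ≤ ℓ × ℓ < n) L
  × (∀ i j → i ∈ L → j ∈ L → ¬ S ∣ i - j ∣)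

Representable : (S : ℕ → Set) → (ℕ → ℕ) → ℕ → ℕ → Set
Representable S a n x =
  Σ (List ℕ) λ L → LegalIndexSet S n L × sum (map a L) ≡ x

IsLID : (S : ℕ → Set) → (ℕ → ℕ) → Set
IsLID S a =
  ∀ n → 1 ≤ n →
    1 ≤ a n
    × ¬ Representable S a n (a n)
    × (∀ m → 1 ≤ m → m < a n → Representable S a n m)

Sk : List ℕ → ℕ → ℕ → Set
Sk T k m = 1 ≤ m × m ≤ k × ¬ (Σ ℕ λ t → t ∈ T × t + m ≡ k)

{-# OPTIONS --safe #-}
-- Write K = k + 1 − c. A nonzero distance D avoids S_k only if D > k or D = k − t with
-- t ∈ T, so any two indices of a legal set are at least K − 1 apart. Below index K legal
-- sets are therefore singletons, which forces a_n = n for n ≤ K; below index 2K they have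
-- at most two elements, the smaller one at most K. Consequently, for u < K the number
-- a_{K+u} − K is the least positive integer that is neither a_{K+u'} − K nor
-- p + (a_{K+u'} − K) with u' < u and p a partner of u' (p + c ≤ u', or p + c = u' + t + 1
-- with t ∈ T). This recursion no longer involves k, so it defines a function offset of T
-- and c alone with a_{K+u} = K + offset(u), that is a_{k+i} = k + offset(i + c − 1) + 1 − c.
module Submission where

open import Defs
open import Data.Nat using (ℕ; zero; suc; _+_; _*_; _∸_; _≤_; _<_; z≤n; s≤s; _≤?_; _<?_; _≟_; ∣_-_∣)
open import Data.Nat.Properties
open import Data.Nat.Induction using (<-rec)
open import Algebra.Properties.CommutativeSemigroup +-commutativeSemigroup using (x∙yz≈y∙xz; x∙yz≈yx∙z; xy∙z≈xz∙y)
open import Data.Integer as ℤ using (ℤ; +_; -[1+_]; ∣_∣; -≤+)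
import Data.Integer.Properties as ℤP
open import Data.List using (List; []; _∷_; map; upTo)
open import Data.List.Extrema.Nat using (max; xs≤max)
open import Data.List.Membership.Propositional using (_∈_; find; lose)
open import Data.List.Membership.Propositional.Properties using (∈-map⁺; ∈-upTo⁺)
open import Data.List.Relation.Unary.All as All using (All; []; _∷_)
open import Data.List.Relation.Unary.AllPairs using ([]; _∷_)
open import Data.List.Relation.Unary.Any using (Any; here; there; any?)
open import Data.Product using (Σ; ∃; ∃-syntax; _×_; _,_; proj₁; proj₂)
open import Data.Sum using (_⊎_; inj₁; inj₂)
open import Function using (_∘_)
open import Relation.Binary.Definitions using (tri<; tri≈; tri>)
open import Relation.Binary.PropositionalEquality
open import Relation.Nullary using (¬_; Dec; yes; no; contradiction)
open import Relation.Nullary.Decidable using (map′; _×-dec_; _⊎-dec_)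
open import Relation.Unary using (Decidable)

pattern 1st = here refl
pattern 2nd = there (here refl)
pattern 3rd = there (there (here refl))

m<n⇒∃[o]0<o×m+o≡n : ∀ {m n} → m < n → ∃[ o ] 0 < o × m + o ≡ n
m<n⇒∃[o]0<o×m+o≡n {m} m<n with o , 1+m+o≡n ← m≤n⇒∃[o]m+o≡n m<n =
  suc o , s≤s z≤n , trans (+-suc m o) 1+m+o≡n

-- IsLID S a unfolds to ∀ n → 1 ≤ n → IsMex (Representable S a n) (a n).
IsMex : (ℕ → Set) → ℕ → Set
IsMex P m = 1 ≤ m × ¬ P m × (∀ v → 1 ≤ v → v < m → P v)

module _ {P : ℕ → Set} where

  IsMex-unique : ∀ {m m′} → IsMex P m → IsMex P m′ → m ≡ m′
  IsMex-unique {m} {m′} (1≤m , ¬Pm , below) (1≤m′ , ¬Pm′ , below′) with <-cmp m m′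
  ... | tri< m<m′ _ _ = contradiction (below′ m 1≤m m<m′) ¬Pm
  ... | tri≈ _ m≡m′ _ = m≡m′
  ... | tri> _ _ m′<m = contradiction (below m′ 1≤m′ m′<m) ¬Pm′

  IsMex-resp : ∀ {Q m} → (∀ {v} → P v → Q v) → (∀ {v} → Q v → P v) → IsMex P m → IsMex Q m
  IsMex-resp P⇒Q Q⇒P (1≤m , ¬Pm , below) =
    1≤m , ¬Pm ∘ Q⇒P , λ v 1≤v v<m → P⇒Q (below v 1≤v v<m)

  IsMex-shift : ∀ {Q m} K →
    (∀ w → 1 ≤ w → w ≤ K → P w) → (∀ {v} → Q v → P (K + v)) → (∀ v → 1 ≤ v → P (K + v) → Q v) →
    IsMex Q m → IsMex P (K + m)
  IsMex-shift {Q} {m} K low lift unlift (1≤m , ¬Qm , Q-below) =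
    ≤-trans 1≤m (m≤n+m m K) , ¬Qm ∘ unlift m 1≤m , P-below
    where
    P-below : ∀ w → 1 ≤ w → w < K + m → P w
    P-below w 1≤w w<K+m with w ≤? K
    ... | yes w≤K = low w 1≤w w≤K
    ... | no w≰K with v , 1≤v , refl ← m<n⇒∃[o]0<o×m+o≡n (≰⇒> w≰K) =
      lift (Q-below v 1≤v (+-cancelˡ-< K v m w<K+m))

module _ {P : ℕ → Set} (P? : Decidable P) where

  firstGap : ∀ s f → ¬ P (s + f) → ∃[ m ] s ≤ m × ¬ P m × (∀ v → s ≤ v → v < m → P v)
  firstGap s zero ¬P[s+0] =
    s , ≤-refl , ¬P[s+0] ∘ subst P (sym (+-identityʳ s)) , λ v s≤v v<s → contradiction v<s (≤⇒≯ s≤v)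
  firstGap s (suc f) ¬P[s+1+f] with P? s
  ... | no ¬Ps = s , ≤-refl , ¬Ps , λ v s≤v v<s → contradiction v<s (≤⇒≯ s≤v)
  ... | yes Ps with firstGap (suc s) f (¬P[s+1+f] ∘ subst P (sym (+-suc s f)))
  ...   | m , s<m , ¬Pm , below = m , <⇒≤ s<m , ¬Pm , below′
    where
    below′ : ∀ v → s ≤ v → v < m → P v
    below′ v s≤v v<m with m≤n⇒m<n∨m≡n s≤v
    ... | inj₁ s<v = below v s<v v<m
    ... | inj₂ refl = Ps

  mex : ∀ B → (∀ {v} → P v → v ≤ B) → ∃ (IsMex P)
  mex B bounded = firstGap 1 B (1+n≰n ∘ bounded)

+∣k+i∣+c≡k+[i+c] : ∀ k i c → ℤ.+0 ℤ.< + k ℤ.+ i → + (∣ + k ℤ.+ i ∣ + c) ≡ + k ℤ.+ (i ℤ.+ + c)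
+∣k+i∣+c≡k+[i+c] k i c 0<k+i = begin
  + (∣ + k ℤ.+ i ∣ + c)     ≡⟨ ℤP.pos-+ ∣ + k ℤ.+ i ∣ c ⟩
  + ∣ + k ℤ.+ i ∣ ℤ.+ + c   ≡⟨ cong (ℤ._+ + c) (ℤP.0≤i⇒+∣i∣≡i (ℤP.<⇒≤ 0<k+i)) ⟩
  + k ℤ.+ i ℤ.+ + c         ≡⟨ ℤP.+-assoc (+ k) i (+ c) ⟩
  + k ℤ.+ (i ℤ.+ + c)       ∎
  where open ≡-Reasoning

x+c≡k+[1+f]⇒x≡k+[f+1-c] : ∀ {x c k f} → x ℤ.+ c ≡ k ℤ.+ (+ 1 ℤ.+ f) → x ≡ k ℤ.+ (f ℤ.+ + 1 ℤ.- c)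
x+c≡k+[1+f]⇒x≡k+[f+1-c] {x} {c} {k} {f} eq = begin
  x                          ≡⟨ ℤP.+-identityʳ x ⟨
  x ℤ.+ ℤ.0ℤ                 ≡⟨ cong (λ m → x ℤ.+ m) (ℤP.+-inverseʳ c) ⟨
  x ℤ.+ (c ℤ.- c)            ≡⟨ ℤP.+-assoc x c (ℤ.- c) ⟨
  x ℤ.+ c ℤ.- c              ≡⟨ cong (ℤ._- c) eq ⟩
  k ℤ.+ (+ 1 ℤ.+ f) ℤ.- c    ≡⟨ ℤP.+-assoc k (+ 1 ℤ.+ f) (ℤ.- c) ⟩
  k ℤ.+ (+ 1 ℤ.+ f ℤ.- c)    ≡⟨ cong (λ m → k ℤ.+ (m ℤ.- c)) (ℤP.+-comm (+ 1) f) ⟩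
  k ℤ.+ (f ℤ.+ + 1 ℤ.- c)    ∎
  where open ≡-Reasoning

module Offsets (T : List ℕ) (c : ℕ) (T≤c : All (_≤ c) T) where

  Partner : ℕ → ℕ → Set
  Partner u p = 1 ≤ p × (p + c ≤ u ⊎ Any (λ t → p + c ≡ suc (u + t)) T)

  Attained : (ℕ → ℕ) → ℕ → ℕ → Set
  Attained g u v = ∃[ u′ ] u′ < u × ∃[ p ] (p ≡ 0 ⊎ Partner u′ p) × p + g u′ ≡ v

  partner? : ∀ u p → Dec (Partner u p)
  partner? u p = 1 ≤? p ×-dec (p + c ≤? u ⊎-dec any? (λ t → p + c ≟ suc (u + t)) T)

  attained? : ∀ g u v → Dec (Attained g u v)
  attained? g u v = map′ fromDifference toDifference (anyUpTo? differenceOk? u)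
    where
    DifferenceOk : ℕ → Set
    DifferenceOk u′ = g u′ ≤ v × (v ∸ g u′ ≡ 0 ⊎ Partner u′ (v ∸ g u′))
    differenceOk? : Decidable DifferenceOk
    differenceOk? u′ = g u′ ≤? v ×-dec (v ∸ g u′ ≟ 0 ⊎-dec partner? u′ (v ∸ g u′))
    fromDifference : ∃[ u′ ] u′ < u × DifferenceOk u′ → Attained g u v
    fromDifference (u′ , u′<u , g≤v , ok) = u′ , u′<u , v ∸ g u′ , ok , m∸n+n≡m g≤v
    toDifference : Attained g u v → ∃[ u′ ] u′ < u × DifferenceOk u′
    toDifference (u′ , u′<u , p , ok , refl) =
      u′ , u′<u , m≤n+m (g u′) p , subst (λ q → q ≡ 0 ⊎ Partner u′ q) (sym (m+n∸n≡m p (g u′))) ok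

  partner≤ : ∀ {u p} → Partner u p → p ≤ suc u
  partner≤ (_ , inj₁ p+c≤u) = m≤n⇒m≤1+n (m+n≤o⇒m≤o _ p+c≤u)
  partner≤ {u} {p} (_ , inj₂ any) with t , t∈T , p+c≡1+u+t ← find any =
    +-cancelʳ-≤ c p (suc u) (subst (_≤ suc u + c) (sym p+c≡1+u+t) (s≤s (+-monoʳ-≤ u (All.lookup T≤c t∈T))))

  attained≤ : ∀ g u {v} → Attained g u v → v ≤ u + max 0 (map g (upTo u))
  attained≤ g u (u′ , u′<u , p , p-ok , refl) =
    +-mono-≤ (p≤u p-ok) (All.lookup (xs≤max 0 (map g (upTo u))) (∈-map⁺ g (∈-upTo⁺ u′<u)))
    where
    p≤u : p ≡ 0 ⊎ Partner u′ p → p ≤ u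
    p≤u (inj₁ refl) = z≤n
    p≤u (inj₂ partner) = ≤-trans (partner≤ partner) u′<u

  next : (ℕ → ℕ) → ℕ → ℕ
  next g u = proj₁ (mex (attained? g u) _ (attained≤ g u))

  next-isMex : ∀ g u → IsMex (Attained g u) (next g u)
  next-isMex g u = proj₂ (mex (attained? g u) _ (attained≤ g u))

  -- offsetsUpTo n tabulates offset on [0, n], realising the course-of-values recursion
  -- offset (suc n) = next offset (suc n).
  offsetsUpTo : ℕ → ℕ → ℕ
  offsetsUpTo zero    _ = 0
  offsetsUpTo (suc n) u with u ≤? n
  ... | yes _ = offsetsUpTo n u
  ... | no  _ = next (offsetsUpTo n) (suc n)

  offset : ℕ → ℕ
  offset u = offsetsUpTo u u

  offsetsUpTo-suc : ∀ {u n} → u ≤ n → offsetsUpTo (suc n) u ≡ offsetsUpTo n u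
  offsetsUpTo-suc {u} {n} u≤n with u ≤? n
  ... | yes _ = refl
  ... | no u≰n = contradiction u≤n u≰n

  offsetsUpTo-offset : ∀ d u → offsetsUpTo (d + u) u ≡ offset u
  offsetsUpTo-offset zero    u = refl
  offsetsUpTo-offset (suc d) u = trans (offsetsUpTo-suc (m≤n+m u d)) (offsetsUpTo-offset d u)

  offset-suc : ∀ n → offset (suc n) ≡ next (offsetsUpTo n) (suc n)
  offset-suc n with suc n ≤? n
  ... | yes 1+n≤n = contradiction 1+n≤n 1+n≰n
  ... | no _ = refl

  attained-cong : ∀ {g h u v} → (∀ {u′} → u′ < u → g u′ ≡ h u′) → Attained g u v → Attained h u v
  attained-cong g≡h (u′ , u′<u , p , p-ok , p+g≡v) =
    u′ , u′<u , p , p-ok , trans (cong (λ m → p + m) (sym (g≡h u′<u))) p+g≡v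

  offset-isMex : ∀ u → 1 ≤ u → IsMex (Attained offset u) (offset u)
  offset-isMex (suc n) _ =
    subst (IsMex (Attained offset (suc n))) (sym (offset-suc n))
      (IsMex-resp (attained-cong table≡offset) (attained-cong (sym ∘ table≡offset))
        (next-isMex (offsetsUpTo n) (suc n)))
    where
    table≡offset : ∀ {u′} → u′ < suc n → offsetsUpTo n u′ ≡ offset u′
    table≡offset {u′} (s≤s u′≤n) =
      subst (λ m → offsetsUpTo m u′ ≡ offset u′) (m∸n+n≡m u′≤n) (offsetsUpTo-offset (n ∸ u′) u′)

  module SkLID (k K : ℕ) (K+c≡1+k : K + c ≡ suc k) where

    S : ℕ → Set
    S = Sk T k

    ¬S-diag : ∀ i → ¬ S ∣ i - i ∣
    ¬S-diag i = subst (λ d → ¬ S d) (sym (∣n-n∣≡0 i)) λ { (() , _) }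

    ¬S-∣m-m+n∣ : ∀ x D → ¬ S ∣ x - x + D ∣ → ¬ S D
    ¬S-∣m-m+n∣ x D = subst (λ d → ¬ S d) (∣m-m+n∣≡n x D)

    ¬S-cases : ∀ {D} → 1 ≤ D → ¬ S D → k < D ⊎ ∃[ t ] t ∈ T × t + D ≡ k
    ¬S-cases {D} 1≤D ¬SD with D ≤? k
    ... | no D≰k = inj₁ (≰⇒> D≰k)
    ... | yes D≤k with any? (λ t → t + D ≟ k) T
    ...   | yes any = inj₂ (find any)
    ...   | no ¬any = contradiction (1≤D , D≤k , λ (t , t∈T , t+D≡k) → ¬any (lose t∈T t+D≡k)) ¬SD

    apart⇒K≤1+D : ∀ {D} → 1 ≤ D → ¬ S D → K ≤ suc D
    apart⇒K≤1+D {D} 1≤D ¬SD with ¬S-cases 1≤D ¬SD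
    ... | inj₁ k<D = m+n≤o⇒m≤o K (subst (_≤ suc D) (sym K+c≡1+k) (m≤n⇒m≤1+n k<D))
    ... | inj₂ (t , t∈T , t+D≡k) = +-cancelʳ-≤ c K (suc D) (begin
      K + c       ≡⟨ K+c≡1+k ⟩
      suc k       ≡⟨ cong suc (sym t+D≡k) ⟩
      suc (t + D) ≤⟨ s≤s (+-monoˡ-≤ D (All.lookup T≤c t∈T)) ⟩
      suc (c + D) ≡⟨ cong suc (+-comm c D) ⟩
      suc D + c   ∎)
      where open ≤-Reasoning

    apart⇒K≤x+D : ∀ {x D} → 1 ≤ x → 1 ≤ D → ¬ S D → K ≤ x + D
    apart⇒K≤x+D {D = D} 1≤x 1≤D ¬SD = ≤-trans (apart⇒K≤1+D 1≤D ¬SD) (+-monoˡ-≤ D 1≤x)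

    -- For indices p and p + D = K + u, the distance D avoids S_k iff p is a partner of u.
    module _ {p D u} (p+D≡K+u : p + D ≡ K + u) where

      D+[p+c]≡1+k+u : D + (p + c) ≡ suc k + u
      D+[p+c]≡1+k+u = begin
        D + (p + c) ≡⟨ x∙yz≈yx∙z D p c ⟩
        (p + D) + c ≡⟨ cong (_+ c) p+D≡K+u ⟩
        (K + u) + c ≡⟨ xy∙z≈xz∙y K u c ⟩
        (K + c) + u ≡⟨ cong (_+ u) K+c≡1+k ⟩
        suc k + u   ∎
        where open ≡-Reasoning

      k<D⇒p+c≤u : k < D → p + c ≤ u
      k<D⇒p+c≤u k<D = +-cancelˡ-≤ (suc k) (p + c) u
        (subst (suc k + (p + c) ≤_) D+[p+c]≡1+k+u (+-monoˡ-≤ (p + c) k<D))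

      p+c≤u⇒k<D : p + c ≤ u → k < D
      p+c≤u⇒k<D p+c≤u = +-cancelʳ-≤ (p + c) (suc k) D
        (subst (suc k + (p + c) ≤_) (sym D+[p+c]≡1+k+u) (+-monoʳ-≤ (suc k) p+c≤u))

      [t+D]+[p+c]≡k+[1+u+t] : ∀ t → (t + D) + (p + c) ≡ k + suc (u + t)
      [t+D]+[p+c]≡k+[1+u+t] t = begin
        (t + D) + (p + c) ≡⟨ +-assoc t D (p + c) ⟩
        t + (D + (p + c)) ≡⟨ cong (λ m → t + m) D+[p+c]≡1+k+u ⟩
        t + (suc k + u)   ≡⟨ x∙yz≈y∙xz t (suc k) u ⟩
        suc k + (t + u)   ≡⟨ cong (λ m → suc (k + m)) (+-comm t u) ⟩
        suc (k + (u + t)) ≡⟨ +-suc k (u + t) ⟨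
        k + suc (u + t)   ∎
        where open ≡-Reasoning

      t+D≡k⇒p+c≡1+u+t : ∀ {t} → t + D ≡ k → p + c ≡ suc (u + t)
      t+D≡k⇒p+c≡1+u+t {t} t+D≡k = +-cancelˡ-≡ k (p + c) (suc (u + t))
        (trans (cong (_+ (p + c)) (sym t+D≡k)) ([t+D]+[p+c]≡k+[1+u+t] t))

      p+c≡1+u+t⇒t+D≡k : ∀ {t} → p + c ≡ suc (u + t) → t + D ≡ k
      p+c≡1+u+t⇒t+D≡k {t} p+c≡1+u+t = +-cancelʳ-≡ (p + c) (t + D) k
        (trans ([t+D]+[p+c]≡k+[1+u+t] t) (cong (λ m → k + m) (sym p+c≡1+u+t)))

      apart⇒partner : 1 ≤ p → 1 ≤ D → ¬ S D → Partner u p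
      apart⇒partner 1≤p 1≤D ¬SD with ¬S-cases 1≤D ¬SD
      ... | inj₁ k<D = 1≤p , inj₁ (k<D⇒p+c≤u k<D)
      ... | inj₂ (t , t∈T , t+D≡k) = 1≤p , inj₂ (lose t∈T (t+D≡k⇒p+c≡1+u+t t+D≡k))

      partner⇒apart : Partner u p → ¬ S D
      partner⇒apart (_ , inj₁ p+c≤u) (_ , D≤k , _) = <⇒≱ (p+c≤u⇒k<D p+c≤u) D≤k
      partner⇒apart (_ , inj₂ any) (_ , _ , ¬k-T) with t , t∈T , p+c≡1+u+t ← find any =
        ¬k-T (t , t∈T , p+c≡1+u+t⇒t+D≡k p+c≡1+u+t)

    module _ (a : ℕ → ℕ) where

      Rep : ℕ → ℕ → Set
      Rep = Representable S a

      single-rep : ∀ {n ℓ w} → 1 ≤ ℓ → ℓ < n → a ℓ ≡ w → Rep n w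
      single-rep {ℓ = ℓ} 1≤ℓ ℓ<n aℓ≡w =
        ℓ ∷ [] , ([] ∷ [] , (1≤ℓ , ℓ<n) ∷ [] , apart) , trans (+-identityʳ (a ℓ)) aℓ≡w
        where
        apart : ∀ i j → i ∈ ℓ ∷ [] → j ∈ ℓ ∷ [] → ¬ S ∣ i - j ∣
        apart _ _ 1st 1st = ¬S-diag ℓ

      pair-rep : ∀ {n x D w} → 1 ≤ x → 1 ≤ D → x + D < n → ¬ S D → a x + a (x + D) ≡ w → Rep n w
      pair-rep {x = x} {D} 1≤x 1≤D x+D<n ¬SD sum≡w =
        x ∷ x + D ∷ [] ,
        ( (<⇒≢ x<x+D ∷ []) ∷ [] ∷ []
        , (1≤x , <-trans x<x+D x+D<n) ∷ (≤-trans 1≤x (<⇒≤ x<x+D) , x+D<n) ∷ []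
        , apart) ,
        trans (cong (λ m → a x + m) (+-identityʳ (a (x + D)))) sum≡w
        where
        x<x+D : x < x + D
        x<x+D = m<m+n x 1≤D
        ¬S∣x-x+D∣ : ¬ S ∣ x - x + D ∣
        ¬S∣x-x+D∣ = subst (λ d → ¬ S d) (sym (∣m-m+n∣≡n x D)) ¬SD
        apart : ∀ i j → i ∈ x ∷ x + D ∷ [] → j ∈ x ∷ x + D ∷ [] → ¬ S ∣ i - j ∣
        apart _ _ 1st 1st = ¬S-diag x
        apart _ _ 1st 2nd = ¬S∣x-x+D∣
        apart _ _ 2nd 1st = subst (λ d → ¬ S d) (∣-∣-comm x (x + D)) ¬S∣x-x+D∣
        apart _ _ 2nd 2nd = ¬S-diag (x + D)

      data SmallRep (n w : ℕ) : Set where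
        empty  : w ≡ 0 → SmallRep n w
        single : ∀ {ℓ} → 1 ≤ ℓ → ℓ < n → a ℓ ≡ w → SmallRep n w
        pair   : ∀ {x D} → 1 ≤ x → 1 ≤ D → x + D < n → ¬ S D → a x + a (x + D) ≡ w → SmallRep n w

      pair-small : ∀ {n x y w} → x < y → 1 ≤ x → y < n → ¬ S ∣ x - y ∣ → a x + a y ≡ w → SmallRep n w
      pair-small {x = x} x<y 1≤x y<n ¬S∣x-y∣ sum≡w with D , 1≤D , refl ← m<n⇒∃[o]0<o×m+o≡n x<y =
        pair 1≤x 1≤D y<n (¬S-∣m-m+n∣ x D ¬S∣x-y∣) sum≡w

      increasing-spread : ∀ {n x y z} → x < y → y < z → 1 ≤ x → z < n →
        ¬ S ∣ x - y ∣ → ¬ S ∣ y - z ∣ → K + K ≤ n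
      increasing-spread {n} {x} x<y y<z 1≤x z<n ¬S∣x-y∣ ¬S∣y-z∣
        with D , 1≤D , refl ← m<n⇒∃[o]0<o×m+o≡n x<y
        with E , 1≤E , refl ← m<n⇒∃[o]0<o×m+o≡n y<z = begin
          K + K                 ≤⟨ +-mono-≤ (apart⇒K≤1+D 1≤D (¬S-∣m-m+n∣ x D ¬S∣x-y∣))
                                            (apart⇒K≤1+D 1≤E (¬S-∣m-m+n∣ (x + D) E ¬S∣y-z∣)) ⟩
          suc D + suc E         ≡⟨ +-suc (suc D) E ⟩
          suc (1 + D + E)       ≤⟨ s≤s (+-monoˡ-≤ E (+-monoˡ-≤ D 1≤x)) ⟩
          suc (x + D + E)       ≤⟨ z<n ⟩
          n                     ∎
        where open ≤-Reasoning

      triple-spread : ∀ {n x y z rest} → LegalIndexSet S n (x ∷ y ∷ z ∷ rest) → K + K ≤ n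
      triple-spread {x = x} {y} {z}
        ((x≢y ∷ x≢z ∷ _) ∷ (y≢z ∷ _) ∷ _ , (1≤x , x<n) ∷ (1≤y , y<n) ∷ (1≤z , z<n) ∷ _ , apart)
        with <-cmp x y | <-cmp y z | <-cmp x z
      ... | tri≈ _ x≡y _ | _ | _ = contradiction x≡y x≢y
      ... | _ | tri≈ _ y≡z _ | _ = contradiction y≡z y≢z
      ... | _ | _ | tri≈ _ x≡z _ = contradiction x≡z x≢z
      ... | tri< x<y _ _ | tri< y<z _ _ | _            = increasing-spread x<y y<z 1≤x z<n (apart _ _ 1st 2nd) (apart _ _ 2nd 3rd)
      ... | tri< x<y _ _ | tri> _ _ z<y | tri< x<z _ _ = increasing-spread x<z z<y 1≤x y<n (apart _ _ 1st 3rd) (apart _ _ 3rd 2nd)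
      ... | tri< x<y _ _ | tri> _ _ z<y | tri> _ _ z<x = increasing-spread z<x x<y 1≤z y<n (apart _ _ 3rd 1st) (apart _ _ 1st 2nd)
      ... | tri> _ _ y<x | tri< y<z _ _ | tri< x<z _ _ = increasing-spread y<x x<z 1≤y z<n (apart _ _ 2nd 1st) (apart _ _ 1st 3rd)
      ... | tri> _ _ y<x | tri< y<z _ _ | tri> _ _ z<x = increasing-spread y<z z<x 1≤y x<n (apart _ _ 2nd 3rd) (apart _ _ 3rd 1st)
      ... | tri> _ _ y<x | tri> _ _ z<y | _            = increasing-spread z<y y<x 1≤z x<n (apart _ _ 3rd 2nd) (apart _ _ 2nd 1st)

      rep⇒small : ∀ {n w} → n < K + K → Rep n w → SmallRep n w
      rep⇒small _ ([] , _ , sum≡w) = empty (sym sum≡w)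
      rep⇒small _ (ℓ ∷ [] , (_ , (1≤ℓ , ℓ<n) ∷ [] , _) , sum≡w) =
        single 1≤ℓ ℓ<n (trans (sym (+-identityʳ (a ℓ))) sum≡w)
      rep⇒small _ (x ∷ y ∷ [] , ((x≢y ∷ []) ∷ _ , (1≤x , x<n) ∷ (1≤y , y<n) ∷ [] , apart) , sum≡w)
        with <-cmp x y
      ... | tri< x<y _ _ = pair-small x<y 1≤x y<n (apart _ _ 1st 2nd)
        (trans (cong (λ m → a x + m) (sym (+-identityʳ (a y)))) sum≡w)
      ... | tri≈ _ x≡y _ = contradiction x≡y x≢y
      ... | tri> _ _ y<x = pair-small y<x 1≤y x<n (apart _ _ 2nd 1st)
        (trans (+-comm (a y) (a x)) (trans (cong (λ m → a x + m) (sym (+-identityʳ (a y)))) sum≡w))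
      rep⇒small n<2K (_ ∷ _ ∷ _ ∷ _ , legal , _) = contradiction (triple-spread legal) (<⇒≱ n<2K)

      initial-isMex : ∀ {n} → 1 ≤ n → n ≤ K → (∀ {ℓ} → ℓ < n → 1 ≤ ℓ → a ℓ ≡ ℓ) → IsMex (Rep n) n
      initial-isMex {n} 1≤n n≤K a≡id = 1≤n , ¬rep , λ v 1≤v v<n → single-rep 1≤v v<n (a≡id v<n 1≤v)
        where
        ¬rep : ¬ Rep n n
        ¬rep r with rep⇒small (≤-<-trans n≤K (m<m+n K (≤-trans 1≤n n≤K))) r
        ... | empty n≡0 = <⇒≢ 1≤n (sym n≡0)
        ... | single 1≤ℓ ℓ<n aℓ≡n = <-irrefl (trans (sym (a≡id ℓ<n 1≤ℓ)) aℓ≡n) ℓ<n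
        ... | pair 1≤x 1≤D x+D<n ¬SD _ =
          n≮n K (≤-<-trans (apart⇒K≤x+D 1≤x 1≤D ¬SD) (<-≤-trans x+D<n n≤K))

      module Shift {u} (1≤u : 1 ≤ u) (u<K : u < K) (a≡id : ∀ ℓ → 1 ≤ ℓ → ℓ ≤ K → a ℓ ≡ ℓ)
                   (a≡K+offset : ∀ {u′} → u′ < u → a (K + u′) ≡ K + offset u′) where

        1<K : 1 < K
        1<K = ≤-<-trans 1≤u u<K

        below-K : ∀ w → 1 ≤ w → w ≤ K → Rep (K + u) w
        below-K w 1≤w w≤K = single-rep 1≤w (≤-<-trans w≤K (m<m+n K 1≤u)) (a≡id w 1≤w w≤K)

        attained⇒rep : ∀ {v} → Attained offset u v → Rep (K + u) (K + v)
        attained⇒rep {v} (u′ , u′<u , _ , inj₁ refl , offset≡v) =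
          single-rep (≤-trans (<⇒≤ 1<K) (m≤m+n K u′)) (+-monoʳ-< K u′<u)
            (trans (a≡K+offset u′<u) (cong (λ m → K + m) offset≡v))
        attained⇒rep {v} (u′ , u′<u , p , inj₂ partner , p+offset≡v)
          with D , 1≤D , p+D≡K+u′ ← m<n⇒∃[o]0<o×m+o≡n (≤-<-trans (partner≤ partner) (+-monoˡ-< u′ 1<K)) =
          pair-rep (proj₁ partner) 1≤D (subst (_< K + u) (sym p+D≡K+u′) (+-monoʳ-< K u′<u))
            (partner⇒apart p+D≡K+u′ partner) (begin
              a p + a (p + D)     ≡⟨ cong₂ _+_ (a≡id p (proj₁ partner) p≤K) (cong a p+D≡K+u′) ⟩
              p + a (K + u′)      ≡⟨ cong (λ m → p + m) (a≡K+offset u′<u) ⟩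
              p + (K + offset u′) ≡⟨ x∙yz≈y∙xz p K (offset u′) ⟩
              K + (p + offset u′) ≡⟨ cong (λ m → K + m) p+offset≡v ⟩
              K + v               ∎)
          where
          open ≡-Reasoning
          p≤K : p ≤ K
          p≤K = ≤-trans (partner≤ partner) (≤-trans u′<u (<⇒≤ u<K))

        rep⇒attained : ∀ v → 1 ≤ v → Rep (K + u) (K + v) → Attained offset u v
        rep⇒attained v 1≤v r with rep⇒small (+-monoʳ-< K u<K) r
        ... | empty K+v≡0 = contradiction (sym K+v≡0) (<⇒≢ (≤-trans 1≤v (m≤n+m v K)))
        ... | single {ℓ} 1≤ℓ ℓ<K+u aℓ≡K+v with ℓ <? K
        ...   | yes ℓ<K = contradiction (trans (sym (a≡id ℓ 1≤ℓ (<⇒≤ ℓ<K))) aℓ≡K+v)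
                                        (<⇒≢ (<-≤-trans ℓ<K (m≤m+n K v)))
        ...   | no ℓ≮K with u′ , refl ← m≤n⇒∃[o]m+o≡n (≮⇒≥ ℓ≮K) =
          u′ , u′<u , 0 , inj₁ refl , +-cancelˡ-≡ K (offset u′) v (trans (sym (a≡K+offset u′<u)) aℓ≡K+v)
          where
          u′<u : u′ < u
          u′<u = +-cancelˡ-< K u′ u ℓ<K+u
        rep⇒attained v 1≤v r | pair {x} {D} 1≤x 1≤D x+D<K+u ¬SD sum≡K+v
          with u′ , K+u′≡x+D ← m≤n⇒∃[o]m+o≡n (apart⇒K≤x+D 1≤x 1≤D ¬SD) =
          u′ , u′<u , x , inj₂ partner , +-cancelˡ-≡ K (x + offset u′) v (begin
            K + (x + offset u′) ≡⟨ x∙yz≈y∙xz K x (offset u′) ⟩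
            x + (K + offset u′) ≡⟨ cong₂ _+_ (a≡id x 1≤x x≤K) (a≡K+offset u′<u) ⟨
            a x + a (K + u′)    ≡⟨ cong (λ m → a x + a m) K+u′≡x+D ⟩
            a x + a (x + D)     ≡⟨ sum≡K+v ⟩
            K + v               ∎)
          where
          open ≡-Reasoning
          partner : Partner u′ x
          partner = apart⇒partner (sym K+u′≡x+D) 1≤x 1≤D ¬SD
          u′<u : u′ < u
          u′<u = +-cancelˡ-< K u′ u (subst (_< K + u) (sym K+u′≡x+D) x+D<K+u)
          x≤K : x ≤ K
          x≤K = ≤-trans (partner≤ partner) (≤-trans u′<u (<⇒≤ u<K))

        shifted-isMex : IsMex (Rep (K + u)) (K + offset u)
        shifted-isMex = IsMex-shift K below-K attained⇒rep rep⇒attained (offset-isMex u 1≤u)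

      module _ (lid : IsLID S a) where

        a-initial : ∀ n → 1 ≤ n → n ≤ K → a n ≡ n
        a-initial = <-rec _ λ n a-below 1≤n n≤K →
          IsMex-unique (lid n 1≤n)
            (initial-isMex 1≤n n≤K λ ℓ<n 1≤ℓ → a-below ℓ<n 1≤ℓ (≤-trans (<⇒≤ ℓ<n) n≤K))

        a-shifted : ∀ u → u < K → a (K + u) ≡ K + offset u
        a-shifted = <-rec _ λ where
          zero _ 0<K → trans (cong a (+-identityʳ K)) (trans (a-initial K 0<K ≤-refl) (sym (+-identityʳ K)))
          (suc m) a-below u<K → IsMex-unique (lid (K + suc m) (≤-trans (s≤s z≤n) (m≤n+m (suc m) K)))
            (Shift.shifted-isMex (s≤s z≤n) u<K a-initial λ u′<u → a-below u′<u (<-trans u′<u u<K))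

  lid-initial : ∀ k a → IsLID (Sk T k) a → ∀ n → 1 ≤ n → n + c ≤ k + 1 → a n ≡ n
  lid-initial k a lid n 1≤n n+c≤k+1 =
    SkLID.a-initial k K K+c≡1+k a lid n 1≤n (+-cancelʳ-≤ c n K (subst (n + c ≤_) (sym K+c≡1+k) n+c≤1+k))
    where
    n+c≤1+k : n + c ≤ suc k
    n+c≤1+k = subst (n + c ≤_) (+-comm k 1) n+c≤k+1
    K : ℕ
    K = suc k ∸ c
    K+c≡1+k : K + c ≡ suc k
    K+c≡1+k = m∸n+n≡m (m+n≤o⇒n≤o n n+c≤1+k)

  lid-shifted : ∀ k a → IsLID (Sk T k) a → ∀ n u → n + c ≡ k + suc u → u + c ≤ k →
    a n + c ≡ k + suc (offset u)
  lid-shifted k a lid n u n+c≡k+1+u u+c≤k = begin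
    a n + c            ≡⟨ cong (λ m → a m + c) n≡K+u ⟩
    a (K + u) + c      ≡⟨ cong (_+ c) (SkLID.a-shifted k K K+c≡1+k a lid u u<K) ⟩
    K + offset u + c   ≡⟨ xy∙z≈xz∙y K (offset u) c ⟩
    K + c + offset u   ≡⟨ cong (_+ offset u) K+c≡1+k ⟩
    suc k + offset u   ≡⟨ +-suc k (offset u) ⟨
    k + suc (offset u) ∎
    where
    open ≡-Reasoning
    K : ℕ
    K = suc k ∸ c
    K+c≡1+k : K + c ≡ suc k
    K+c≡1+k = m∸n+n≡m (≤-trans (m≤n+m c u) (m≤n⇒m≤1+n u+c≤k))
    u<K : u < K
    u<K = +-cancelʳ-≤ c (suc u) K (subst (suc (u + c) ≤_) (sym K+c≡1+k) (s≤s u+c≤k))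
    n≡K+u : n ≡ K + u
    n≡K+u = +-cancelʳ-≡ c n (K + u) (begin
      n + c     ≡⟨ n+c≡k+1+u ⟩
      k + suc u ≡⟨ +-suc k u ⟩
      suc k + u ≡⟨ cong (_+ u) K+c≡1+k ⟨
      K + c + u ≡⟨ xy∙z≈xz∙y K c u ⟩
      K + u + c ∎)

  -- For i + c ≤ 0 the index k + i lies in the initial segment, where a_{k+i} = k + i.
  f : ℤ → ℤ
  f i with i ℤ.+ + c
  ... | + suc u = + offset u ℤ.+ + 1 ℤ.- + c
  ... | _       = i

  lid-ℤ-initial : ∀ i k → ℤ.+0 ℤ.< + k ℤ.+ i → i ℤ.+ + c ℤ.≤ ℤ.+0 →
    ∀ a → IsLID (Sk T k) a → + (a ∣ + k ℤ.+ i ∣) ≡ + k ℤ.+ i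
  lid-ℤ-initial i k 0<k+i i+c≤0 a lid =
    trans (cong +_ (lid-initial k a lid n 1≤n (≤-trans n+c≤k (m≤m+n k 1)))) +n≡k+i
    where
    n : ℕ
    n = ∣ + k ℤ.+ i ∣
    +n≡k+i : + n ≡ + k ℤ.+ i
    +n≡k+i = ℤP.0≤i⇒+∣i∣≡i (ℤP.<⇒≤ 0<k+i)
    1≤n : 1 ≤ n
    1≤n = ℤP.drop‿+<+ (subst (ℤ.+0 ℤ.<_) (sym +n≡k+i) 0<k+i)
    n+c≤k : n + c ≤ k
    n+c≤k = ℤP.drop‿+≤+ (begin
      + (n + c)           ≡⟨ +∣k+i∣+c≡k+[i+c] k i c 0<k+i ⟩
      + k ℤ.+ (i ℤ.+ + c) ≤⟨ ℤP.+-monoʳ-≤ (+ k) i+c≤0 ⟩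
      + k ℤ.+ ℤ.+0        ≡⟨ ℤP.+-identityʳ (+ k) ⟩
      + k                 ∎)
      where open ℤP.≤-Reasoning

  lid-ℤ-shifted : ∀ i k u → i ℤ.+ + c ≡ + suc u → ℤ.+0 ℤ.< + k ℤ.+ i → i ℤ.+ + (2 * c) ℤ.≤ + k ℤ.+ + 1 →
    ∀ a → IsLID (Sk T k) a → + (a ∣ + k ℤ.+ i ∣) ≡ + k ℤ.+ (+ offset u ℤ.+ + 1 ℤ.- + c)
  lid-ℤ-shifted i k u i+c≡1+u 0<k+i i+2c≤k+1 a lid =
    x+c≡k+[1+f]⇒x≡k+[f+1-c] {c = + c} {+ k} {+ offset u} +an+c≡k+[1+offset]
    where
    n : ℕ
    n = ∣ + k ℤ.+ i ∣
    n+c≡k+1+u : n + c ≡ k + suc u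
    n+c≡k+1+u = ℤP.+-injective (begin
      + (n + c)           ≡⟨ +∣k+i∣+c≡k+[i+c] k i c 0<k+i ⟩
      + k ℤ.+ (i ℤ.+ + c) ≡⟨ cong (λ m → + k ℤ.+ m) i+c≡1+u ⟩
      + k ℤ.+ + suc u     ≡⟨ ℤP.pos-+ k (suc u) ⟨
      + (k + suc u)       ∎)
      where open ≡-Reasoning
    +[1+u+c]≤+[k+1] : + (suc u + c) ℤ.≤ + (k + 1)
    +[1+u+c]≤+[k+1] = begin
      + (suc u + c)       ≡⟨ ℤP.pos-+ (suc u) c ⟩
      + suc u ℤ.+ + c     ≡⟨ cong (ℤ._+ + c) i+c≡1+u ⟨
      i ℤ.+ + c ℤ.+ + c   ≡⟨ ℤP.+-assoc i (+ c) (+ c) ⟩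
      i ℤ.+ (+ c ℤ.+ + c) ≡⟨ cong (λ m → i ℤ.+ (+ c ℤ.+ + m)) (+-identityʳ c) ⟨
      i ℤ.+ (+ c ℤ.+ + (c + 0)) ≡⟨ cong (λ m → i ℤ.+ m) (ℤP.pos-+ c (c + 0)) ⟨
      i ℤ.+ + (2 * c)     ≤⟨ i+2c≤k+1 ⟩
      + k ℤ.+ + 1         ≡⟨ ℤP.pos-+ k 1 ⟨
      + (k + 1)           ∎
      where open ℤP.≤-Reasoning
    u+c≤k : u + c ≤ k
    u+c≤k = ≤-pred (subst (suc u + c ≤_) (+-comm k 1) (ℤP.drop‿+≤+ +[1+u+c]≤+[k+1]))
    +an+c≡k+[1+offset] : + a n ℤ.+ + c ≡ + k ℤ.+ (+ 1 ℤ.+ + offset u)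
    +an+c≡k+[1+offset] = begin
      + a n ℤ.+ + c                ≡⟨ ℤP.pos-+ (a n) c ⟨
      + (a n + c)                  ≡⟨ cong +_ (lid-shifted k a lid n u n+c≡k+1+u u+c≤k) ⟩
      + (k + suc (offset u))       ≡⟨ ℤP.pos-+ k (suc (offset u)) ⟩
      + k ℤ.+ + suc (offset u)     ≡⟨ cong (λ m → + k ℤ.+ m) (ℤP.pos-+ 1 (offset u)) ⟩
      + k ℤ.+ (+ 1 ℤ.+ + offset u) ∎
      where open ≡-Reasoning

  lid-ℤ : ∀ i k → ℤ.+0 ℤ.< + k ℤ.+ i → i ℤ.+ + (2 * c) ℤ.≤ + k ℤ.+ + 1 →
    ∀ a → IsLID (Sk T k) a → + (a ∣ + k ℤ.+ i ∣) ≡ + k ℤ.+ f i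
  lid-ℤ i k 0<k+i i+2c≤k+1 a lid with i ℤ.+ + c in i+c≡
  ... | + suc u  = lid-ℤ-shifted i k u i+c≡ 0<k+i i+2c≤k+1 a lid
  ... | + zero   = lid-ℤ-initial i k 0<k+i (ℤP.≤-reflexive i+c≡) a lid
  ... | -[1+ _ ] = lid-ℤ-initial i k 0<k+i (ℤP.≤-trans (ℤP.≤-reflexive i+c≡) -≤+) a lid

lemma3p7 : (T : List ℕ) → T ≢ [] → All (λ t → 1 ≤ t) T →
    (c : ℕ) → c ∈ T → All (λ t → t ≤ c) T →
    ((k : ℕ) → 1 ≤ k → (a : ℕ → ℕ) → IsLID (Sk T k) a →
       (n : ℕ) → 1 ≤ n → n + c ≤ k + 1 → a n ≡ n)
    × ((i : ℤ) → Σ ℤ λ f →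
       (k : ℕ) → 1 ≤ k → ℤ.+0 ℤ.< + k ℤ.+ i →
         i ℤ.+ + (2 * c) ℤ.≤ + k ℤ.+ + 1 →
         (a : ℕ → ℕ) → IsLID (Sk T k) a →
         + (a ∣ + k ℤ.+ i ∣) ≡ + k ℤ.+ f)
lemma3p7 T _ _ c _ T≤c = (λ k _ → lid-initial k) , λ i → f i , λ k _ → lid-ℤ i k
  where open Offsets T c T≤c
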